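{- Let $D$ be a connected acyclic digraph and let $S$ be a set of vertices of $D$. Then $S$ is a connected convex set in $D$ if and only if $S$ is a connected convex set in the transitive closure $D^{TC}$ of $D$.
   Context: A set $X$ of vertices of an acyclic digraph $D$ is convex if $X\neq\emptyset$ and there is no directed path between two vertices of $X$ which contains a vertex not in $X$. A set $X$ is connected if $X\neq\emptyset$ and the underlying undirected graph of the subgraph $D[X]$ induced by $X$ is connected. A set is a connected convex set (cc-set) if it is both connected and convex. The transitive closure $D^{TC}$ of $D$ is the digraph with $V(D^{TC})=V(D)$ in which $xy$ is an arc if and only if there is a directed path from $x$ to $y$ in $D$. -}

module Defs where

open import Level using (Level; _⊔_; suc)
open import Data.Nat using (ℕ)
open import Data.Fin using (Fin)
open import Data.Product using (Σ; ∃; _×_; _,_)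
open import Data.Sum using (_⊎_)
open import Relation.Nullary using (¬_)
open import Data.Unit using (⊤)

-- A (finite) digraph on vertex set Fin n, given by its arc relation.
-- Loops are irrelevant here: D is acyclic so Arc x x never holds.
record Digraph (n : ℕ) : Set₁ where
  field
    Arc : Fin n → Fin n → Set

open Digraph public

VSet : ℕ → Set₁
VSet n = Fin n → Set

-- Directed walks from x to y along the arcs of D (possibly of length 0).
-- In an acyclic digraph every directed walk is a directed path.
data DPath {n : ℕ} (D : Digraph n) : Fin n → Fin n → Set where
  [] : ∀ {x} → DPath D x x
  _∷_ : ∀ {x y z} → Arc D x y → DPath D y z → DPath D x z

data OnPath {n : ℕ} {D : Digraph n} (v : Fin n) : ∀ {x y} → DPath D x y → Set where
  here : ∀ {y} {p : DPath D v y} → OnPath v p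
  there : ∀ {x y z} {a : Arc D x y} {p : DPath D y z} → OnPath v p → OnPath v (a ∷ p)

NEPath : ∀ {n} → Digraph n → Fin n → Fin n → Set
NEPath D x z = ∃ λ y → Arc D x y × DPath D y z

Acyclic : ∀ {n} → Digraph n → Set
Acyclic D = ∀ x → ¬ NEPath D x x

UEdge : ∀ {n} → Digraph n → Fin n → Fin n → Set
UEdge D x y = Arc D x y ⊎ Arc D y x

data UWalkIn {n : ℕ} (D : Digraph n) (X : VSet n) : Fin n → Fin n → Set where
  [] : ∀ {x} → X x → UWalkIn D X x x
  _∷_ : ∀ {x y z} → X x → UEdge D x y → UWalkIn D X y z → UWalkIn D X x z

Nonempty : ∀ {n} → VSet n → Set
Nonempty X = ∃ λ x → X x

Full : ∀ {n} → VSet n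
Full _ = ⊤

ConnectedSet : ∀ {n} → Digraph n → VSet n → Set
ConnectedSet D X = Nonempty X × (∀ x y → X x → X y → UWalkIn D X x y)

-- The digraph D is connected (its underlying undirected graph is connected).
-- Note: this includes V(D) ≠ ∅.
ConnectedDigraph : ∀ {n} → Digraph n → Set
ConnectedDigraph D = ConnectedSet D Full

Convex : ∀ {n} → Digraph n → VSet n → Set
Convex D X = Nonempty X ×
  (∀ x y (p : DPath D x y) → X x → X y → ∀ v → OnPath v p → X v)

CCSet : ∀ {n} → Digraph n → VSet n → Set
CCSet D X = ConnectedSet D X × Convex D X

TC : ∀ {n} → Digraph n → Digraph n
TC D = record { Arc = NEPath D }

-- A directed path of the transitive closure expands into a directed path of D through the
-- same vertices (and more), and each arc of D is an arc of the closure; hence the two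
-- digraphs have the same convex sets. For a convex set X, an arc of the closure between
-- vertices of X expands into a path of D inside X, so X is connected in D exactly when it
-- is connected in the closure.
module Submission where

open import Defs
open import Data.Nat using (ℕ)
open import Data.Product using (_,_; proj₂; map₂)
open import Data.Sum using (inj₁; inj₂)
open import Function.Bundles using (_⇔_; mk⇔; Equivalence)

private
  variable
    n : ℕ
    D D′ : Digraph n
    X : VSet n

module _ {D : Digraph n} where

  _++ₚ_ : ∀ {x y z} → DPath D x y → DPath D y z → DPath D x z
  [] ++ₚ r = r
  (a ∷ q) ++ₚ r = a ∷ (q ++ₚ r)

  onPath-++ʳ : ∀ {v x y z} (q : DPath D x y) {r : DPath D y z} →
    OnPath v r → OnPath v (q ++ₚ r)
  onPath-++ʳ [] o = o
  onPath-++ʳ (a ∷ q) o = there (onPath-++ʳ q o)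

  toTC : ∀ {x y} → DPath D x y → DPath (TC D) x y
  toTC [] = []
  toTC (a ∷ p) = (_ , a , []) ∷ toTC p

  onPath-toTC : ∀ {v x y} (p : DPath D x y) → OnPath v p → OnPath v (toTC p)
  onPath-toTC [] here = here
  onPath-toTC (a ∷ p) here = here
  onPath-toTC (a ∷ p) (there o) = there (onPath-toTC p o)

  fromTC : ∀ {x y} → DPath (TC D) x y → DPath D x y
  fromTC [] = []
  fromTC ((_ , a , q) ∷ p) = a ∷ (q ++ₚ fromTC p)

  onPath-fromTC : ∀ {v x y} (p : DPath (TC D) x y) → OnPath v p → OnPath v (fromTC p)
  onPath-fromTC [] here = here
  onPath-fromTC (_ ∷ p) here = here
  onPath-fromTC ((_ , a , q) ∷ p) (there o) = there (onPath-++ʳ q (onPath-fromTC p o))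

PathClosed : Digraph n → VSet n → Set
PathClosed D X = ∀ x y (p : DPath D x y) → X x → X y → ∀ v → OnPath v p → X v

pathClosed⇔pathClosed-TC : PathClosed D X ⇔ PathClosed (TC D) X
pathClosed⇔pathClosed-TC = mk⇔
  (λ cl x y p sx sy v o → cl x y (fromTC p) sx sy v (onPath-fromTC p o))
  (λ cl x y p sx sy v o → cl x y (toTC p) sx sy v (onPath-toTC p o))

convex⇔convex-TC : Convex D X ⇔ Convex (TC D) X
convex⇔convex-TC = mk⇔ (map₂ (Equivalence.to pathClosed⇔pathClosed-TC))
                       (map₂ (Equivalence.from pathClosed⇔pathClosed-TC))

UEdge-sym : ∀ {x y} → UEdge D x y → UEdge D y x
UEdge-sym (inj₁ a) = inj₂ a
UEdge-sym (inj₂ a) = inj₁ a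

module _ {D : Digraph n} {X : VSet n} where

  head : ∀ {x y} → UWalkIn D X x y → X x
  head ([] s) = s
  head (_∷_ s _ _) = s

  _++ᵤ_ : ∀ {x y z} → UWalkIn D X x y → UWalkIn D X y z → UWalkIn D X x z
  [] _ ++ᵤ w = w
  _∷_ s e w ++ᵤ w′ = _∷_ s e (w ++ᵤ w′)

  reverse : ∀ {x y} → UWalkIn D X x y → UWalkIn D X y x
  reverse ([] s) = [] s
  reverse (_∷_ s e w) = reverse w ++ᵤ _∷_ (head w) (UEdge-sym {D = D} e) ([] s)

  fromDPath : ∀ {x y} (p : DPath D x y) → (∀ v → OnPath v p → X v) → UWalkIn D X x y
  fromDPath [] inX = [] (inX _ here)
  fromDPath (a ∷ p) inX = _∷_ (inX _ here) (inj₁ a) (fromDPath p (λ v o → inX v (there o)))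

UWalkIn-bind : (∀ {x y} → X x → X y → UEdge D x y → UWalkIn D′ X x y) →
  ∀ {x y} → UWalkIn D X x y → UWalkIn D′ X x y
UWalkIn-bind f ([] s) = [] s
UWalkIn-bind f (_∷_ s e w) = f s (head w) e ++ᵤ UWalkIn-bind f w

ConnectedSet-mono : (∀ {x y} → X x → X y → UEdge D x y → UWalkIn D′ X x y) →
  ConnectedSet D X → ConnectedSet D′ X
ConnectedSet-mono f = map₂ (λ walk x y sx sy → UWalkIn-bind f (walk x y sx sy))

connected⇒connected-TC : ConnectedSet D X → ConnectedSet (TC D) X
connected⇒connected-TC = ConnectedSet-mono λ where
  sx sy (inj₁ a) → _∷_ sx (inj₁ (_ , a , [])) ([] sy)
  sx sy (inj₂ a) → _∷_ sx (inj₂ (_ , a , [])) ([] sy)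

arc-TC⇒walk : PathClosed D X → ∀ {x y} → X x → X y → Arc (TC D) x y → UWalkIn D X x y
arc-TC⇒walk cl {x} {y} sx sy (_ , a , q) = fromDPath (a ∷ q) (cl x y (a ∷ q) sx sy)

connected-TC⇒connected : PathClosed D X → ConnectedSet (TC D) X → ConnectedSet D X
connected-TC⇒connected cl = ConnectedSet-mono λ where
  sx sy (inj₁ e) → arc-TC⇒walk cl sx sy e
  sx sy (inj₂ e) → reverse (arc-TC⇒walk cl sy sx e)

lemma1 : ∀ (n : ℕ) (D : Digraph n) → Acyclic D → ConnectedDigraph D →
    (S : VSet n) → CCSet D S ⇔ CCSet (TC D) S
lemma1 n D _ _ S = mk⇔
  (λ (con , cvx) → connected⇒connected-TC con , Equivalence.to convex⇔convex-TC cvx)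
  (λ (con , cvx) → let cvxD = Equivalence.from convex⇔convex-TC cvx
                   in connected-TC⇒connected (proj₂ cvxD) con , cvxD)
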